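{- Let $m\ge 2$, $r,s\ge 1$ be integers, let $i_0 \in [m]$, and for each $i \in [m]\setminus\{i_0\}$ choose $j_i \in [r]$. Then $S = \bigcup_{i \in [m]\setminus\{i_0\}} S_{i,j_i} \cup \{c\}$ is a fort of $Py(m,r,s)$.
   Context: The peony graph $Py(m,r,s)$ has vertex set $\{c\} \cup \{u_i\}_{i=1}^m \cup \{v_{i,j,k} : i \in [m], j \in [r], k \in [s]\}$, where $[n]=\{1,\dots,n\}$ and indices $i$ are taken modulo $m$ (so $v_{0,j,k}=v_{m,j,k}$). Two distinct vertices $w,z$ are adjacent iff: $\{w,z\}=\{c,u_i\}$; $\{w,z\}=\{u_i,v_{i,j,1}\}$; $\{w,z\}=\{u_i,v_{i-1,j,s}\}$; or $\{w,z\}=\{v_{i,j,k},v_{i,j,k+1}\}$ with $k\in[s-1]$ (for some $i\in[m]$, $j\in[r]$). The layer $S_{i,j}$ is $\{v_{i,j,k}\}_{k=1}^s$. A set $S \subseteq V(G)$ is a fort of $G$ if every vertex $u \in V(G)\setminus S$ satisfies $|N_G(u)\cap S| \ne 1$, where $N_G(u)$ is the set of neighbors of $u$. -}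

module Defs where

open import Data.Nat using (ℕ; suc)
open import Data.Sum using (_⊎_)
open import Data.Fin using (Fin; toℕ)
open import Data.Product using (Σ; _×_)
open import Relation.Binary.PropositionalEquality using (_≡_)
open import Relation.Nullary using (¬_)

-- Vertices of the peony graph Py(m,r,s). Indices are 0-based:
-- u i  is u_{i+1},  v i j k  is v_{i+1,j+1,k+1}.
data PyV (m r s : ℕ) : Set where
  c : PyV m r s
  u : Fin m → PyV m r s
  v : Fin m → Fin r → Fin s → PyV m r s

NextMod : ℕ → ℕ → ℕ → Set
NextMod m a b = (b ≡ suc a) ⊎ ((suc a ≡ m) × (b ≡ 0))

-- Directed version of the edge relation (each edge listed once).
-- In 0-based terms u_i ~ v_{i-1,j,s} (mod m) reads: u i' ~ v i j (last)
-- where i' ≡ i + 1 (mod m).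
data Edge (m r s : ℕ) : PyV m r s → PyV m r s → Set where
  e-cu   : ∀ i → Edge m r s c (u i)
  e-uv1  : ∀ i j k → toℕ k ≡ 0 → Edge m r s (u i) (v i j k)
  e-uvs  : ∀ i i' j k → NextMod m (toℕ i) (toℕ i') → suc (toℕ k) ≡ s →
           Edge m r s (u i') (v i j k)
  e-path : ∀ i j k k' → toℕ k' ≡ suc (toℕ k) → Edge m r s (v i j k) (v i j k')

data Adj (m r s : ℕ) (w z : PyV m r s) : Set where
  fwd : Edge m r s w z → Adj m r s w z
  bwd : Edge m r s z w → Adj m r s w z

ExactlyOneNbrIn : ∀ {m r s} → (PyV m r s → Set) → PyV m r s → Set
ExactlyOneNbrIn {m} {r} {s} S x =
  Σ (PyV m r s) λ w → Adj m r s x w × S w ×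
    (∀ w' → Adj m r s x w' → S w' → w' ≡ w)

IsFort : ∀ {m r s} → (PyV m r s → Set) → Set
IsFort {m} {r} {s} S = ∀ x → ¬ S x → ¬ ExactlyOneNbrIn S x

data PeonyFortSet {m r s : ℕ} (i0 : Fin m) (js : Fin m → Fin r) : PyV m r s → Set where
  in-c : PeonyFortSet i0 js c
  in-v : ∀ i k → ¬ i ≡ i0 → PeonyFortSet i0 js (v i (js i) k)

{-# OPTIONS --safe #-}
module Submission where

open import Defs
open import Data.Nat using (ℕ; _≤_; suc; s≤s; z≤n)
open import Data.Nat.Properties using (1+n≢n)
open import Data.Fin using (Fin; toℕ; fromℕ; inject₁; _≟_)
open import Data.Fin.Properties using (toℕ-fromℕ; toℕ-inject₁)
open import Data.Sum using (inj₁; inj₂)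
open import Data.Product using (_×_; _,_; ∃; ∃₂)
open import Relation.Binary.PropositionalEquality using (_≢_; refl; sym; trans; cong)
open import Relation.Nullary using (¬_; yes; no; contradiction)

-- A vertex v_{i,j,k} outside S has no neighbour in S: S is a union of whole
-- layers and c, and the remaining neighbours of a layer vertex are hubs u.
-- Every hub u_i has two neighbours in S, namely c and either the first vertex
-- of S_{i,j_i} (if i ≠ i0) or the last vertex of S_{i-1,j_{i-1}} (if i = i0;
-- here m ≥ 2 guarantees i-1 ≠ i0).

predecessor : ∀ {m} → 2 ≤ m → (i : Fin m) →
  ∃ λ p → NextMod m (toℕ p) (toℕ i) × p ≢ i
predecessor {suc (suc m)} (s≤s (s≤s z≤n)) Fin.zero =
  fromℕ (suc m) , inj₂ (cong suc (toℕ-fromℕ (suc m)) , refl) , λ ()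
predecessor {suc (suc m)} (s≤s (s≤s z≤n)) (Fin.suc a) =
  inject₁ a , inj₁ (cong suc (sym (toℕ-inject₁ a))) ,
  λ eq → 1+n≢n (trans (cong toℕ (sym eq)) (toℕ-inject₁ a))

two-nbrs⇒¬ExactlyOneNbrIn : ∀ {m r s} {S : PyV m r s → Set} {x a b} →
  Adj m r s x a → S a → Adj m r s x b → S b → a ≢ b → ¬ ExactlyOneNbrIn S x
two-nbrs⇒¬ExactlyOneNbrIn x~a Sa x~b Sb a≢b (_ , _ , _ , unique) =
  a≢b (trans (unique _ x~a Sa) (sym (unique _ x~b Sb)))

module _ {m r s : ℕ} {i0 : Fin m} {js : Fin m → Fin r} where

  PeonyFortSet-adj-v : ∀ {i j k w} → Adj m r s (v i j k) w →
    PeonyFortSet i0 js w → PeonyFortSet i0 js (v i j k)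
  PeonyFortSet-adj-v (fwd ()) in-c
  PeonyFortSet-adj-v (bwd ()) in-c
  PeonyFortSet-adj-v (fwd (e-path _ _ k _ _)) (in-v i _ i≢i0) = in-v i k i≢i0
  PeonyFortSet-adj-v (bwd (e-path _ _ _ k _)) (in-v i _ i≢i0) = in-v i k i≢i0

  u-adj-fort-layer : 2 ≤ m → 1 ≤ s → (i : Fin m) →
    ∃₂ λ i′ k → Adj m r s (u i) (v i′ (js i′) k) × i′ ≢ i0
  u-adj-fort-layer 2≤m (s≤s {n = s′} z≤n) i with i ≟ i0
  ... | no i≢i0 = i , Fin.zero , fwd (e-uv1 i (js i) Fin.zero refl) , i≢i0
  ... | yes refl with predecessor 2≤m i
  ...   | p , p+1≡i , p≢i =
    p , fromℕ s′ , fwd (e-uvs p i (js p) (fromℕ s′) p+1≡i (cong suc (toℕ-fromℕ s′))) , p≢i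

claim3 : (m r s : ℕ) → 2 ≤ m → 1 ≤ r → 1 ≤ s →
    (i0 : Fin m) → (js : Fin m → Fin r) →
    IsFort {m} {r} {s} (PeonyFortSet i0 js)
claim3 m r s _ _ _ i0 js c c∉S = contradiction in-c c∉S
claim3 m r s 2≤m _ 1≤s i0 js (u i) _ =
  let i′ , k , u~v , i′≢i0 = u-adj-fort-layer {i0 = i0} {js} 2≤m 1≤s i
  in two-nbrs⇒¬ExactlyOneNbrIn (bwd (e-cu i)) in-c u~v (in-v i′ k i′≢i0) λ ()
claim3 m r s _ _ _ i0 js (v i j k) v∉S (_ , v~w , Sw , _) =
  v∉S (PeonyFortSet-adj-v v~w Sw)
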